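{- For all $n\ge 4$, if $\phi$ is a Gallai coloring of $E(K_n)$ using exactly the three colors red, green, blue that is special (vertex-special or edge-special), then $w(\phi)=2^n+3$.
   Context: A Gallai coloring of $K_m$ is a coloring $E(K_m)\to\{\text{red},\text{green},\text{blue}\}$ with no rainbow triangle (triangle whose three edges have three distinct colors). For a Gallai coloring $\psi$ of $K_m$, regard $K_{m+1}$ as $K_m$ plus a new vertex $u$; $w(\psi)$ is the number of colorings of the edges from $u$ to $V(K_m)$ with colors in $\{\text{red},\text{green},\text{blue}\}$ such that the resulting coloring of $E(K_{m+1})$ is Gallai. A vertex is monochromatic (of color $c$) if all its incident edges have color $c$. A coloring of $E(K_n)$ with exactly three colors is vertex-special if there is a vertex $v$ monochromatic in some color $c$ and the coloring of $K_n-v$ uses only the two colors other than $c$, with all edges of $K_n-v$ of one of these colors except exactly one edge of the other; it is edge-special if there are two non-adjacent edges of two different colors $c_1,c_2$ and all other edges have the third color. -}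

module Defs where

open import Data.Nat using (ℕ; zero; suc)
open import Data.Fin using (Fin; zero; suc)
open import Data.Vec using (Vec; lookup)
open import Data.List using (List; length)
open import Data.List.Membership.Propositional using (_∈_)
open import Data.List.Relation.Unary.Unique.Propositional using (Unique)
open import Data.Product using (Σ; ∃; ∃-syntax; _×_; _,_)
open import Data.Sum using (_⊎_)
open import Relation.Nullary using (¬_)
open import Relation.Binary.PropositionalEquality using (_≡_; _≢_)
open import Function.Bundles using (_⇔_)

data Color : Set where
  red green blue : Color

-- A 3-edge-colouring of K_n: a colour for each ordered pair of vertices,
-- required to be symmetric; the values on the diagonal (i , i) are
-- meaningless and every notion below only looks at pairs of distinct vertices.
Coloring : ℕ → Set
Coloring n = Fin n → Fin n → Color

Symmetric : ∀ {n} → Coloring n → Set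
Symmetric {n} φ = (i j : Fin n) → φ i j ≡ φ j i

Distinct3 : Color → Color → Color → Set
Distinct3 a b c = a ≢ b × b ≢ c × a ≢ c

Gallai : ∀ {n} → Coloring n → Set
Gallai {n} φ = (i j k : Fin n) → i ≢ j → j ≢ k → i ≢ k →
  ¬ Distinct3 (φ i j) (φ j k) (φ i k)

Occurs : ∀ {n} → Coloring n → Color → Set
Occurs {n} φ c = ∃[ i ] ∃[ j ] (i ≢ j × φ i j ≡ c)

UsesAllThree : ∀ {n} → Coloring n → Set
UsesAllThree φ = Occurs φ red × Occurs φ green × Occurs φ blue

SameEdge : ∀ {n} → Fin n → Fin n → Fin n → Fin n → Set
SameEdge x y a b = (x ≡ a × y ≡ b) ⊎ (x ≡ b × y ≡ a)

VertexSpecial : ∀ {n} → Coloring n → Set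
VertexSpecial {n} φ =
  Σ (Fin n) λ v → Σ Color λ c0 → Σ Color λ c1 → Σ Color λ c2 →
  Σ (Fin n) λ a → Σ (Fin n) λ b →
    Distinct3 c0 c1 c2 ×
    ((x : Fin n) → x ≢ v → φ v x ≡ c0) ×
    a ≢ b × a ≢ v × b ≢ v × φ a b ≡ c2 ×
    ((x y : Fin n) → x ≢ y → x ≢ v → y ≢ v → ¬ SameEdge x y a b → φ x y ≡ c1)

EdgeSpecial : ∀ {n} → Coloring n → Set
EdgeSpecial {n} φ =
  Σ Color λ c1 → Σ Color λ c2 → Σ Color λ c3 →
  Σ (Fin n) λ a → Σ (Fin n) λ b → Σ (Fin n) λ c → Σ (Fin n) λ d →
    Distinct3 c1 c2 c3 ×
    (a ≢ b × a ≢ c × a ≢ d × b ≢ c × b ≢ d × c ≢ d) ×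
    φ a b ≡ c1 × φ c d ≡ c2 ×
    ((x y : Fin n) → x ≢ y → ¬ SameEdge x y a b → ¬ SameEdge x y c d → φ x y ≡ c3)

Special : ∀ {n} → Coloring n → Set
Special φ = VertexSpecial φ ⊎ EdgeSpecial φ

-- K_{n+1} = K_n plus a new vertex u (= zero); f gives the colours of the
-- edges from u to the old vertices (old vertex i becomes suc i).
extend : ∀ {n} → Coloring n → Vec Color n → Coloring (suc n)
extend φ f zero    zero    = red   -- diagonal, irrelevant
extend φ f zero    (suc j) = lookup f j
extend φ f (suc i) zero    = lookup f i
extend φ f (suc i) (suc j) = φ i j

-- w(φ) = k : the extensions f making the colouring of K_{n+1} Gallai are
-- exactly the entries of a duplicate-free list of length k.
HasWeight : ∀ {n} → Coloring n → ℕ → Set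
HasWeight {n} φ k =
  Σ (List (Vec Color n)) λ L →
    Unique L × ((f : Vec Color n) → (f ∈ L) ⇔ Gallai (extend φ f)) × length L ≡ k

-- Put the special vertices first by a vertex permutation. The colouring is then a cone: a head on
-- k = 3 (vertex-special) or k = 4 (edge-special) vertices, a tail of m vertices spanning a clique
-- of a single colour e, and every head vertex joined to the whole tail by a single colour.
-- A colour vector g ++ t for the new vertex creates no rainbow triangle iff g does so on the head,
-- every entry of t is allowed by every entry of g, and t avoids one of the two colours p, q other
-- than e (a p and a q in the tail would span a rainbow triangle with the new vertex). By
-- inclusion–exclusion the number of such tails is |S∖p|^m + |S∖q|^m − |S∖p∖q|^m for the set S of
-- allowed colours, so the total is an integer combination of 0^m, 1^m, 2^m, 3^m summed over the
-- finitely many heads g; these combinations are evaluated for each choice of the three colours.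

module Submission where

open import Defs
open import Data.Bool using (true; false; if_then_else_)
open import Data.Empty using (⊥; ⊥-elim)
open import Data.Fin using (Fin; zero; suc; _↑ˡ_; _↑ʳ_; punchIn; punchOut)
open import Data.Fin.Permutation using (Permutation′; _⟨$⟩ʳ_; inverseˡ; inverseʳ; insert; id; flip)
open import Data.Fin.Properties using (any?; 0≢1+n; ↑ˡ-injective; ↑ʳ-injective; suc-injective; punchOut-injective; punchIn-punchOut) renaming (_≟_ to _≟ᶠ_; all? to ∀ᶠ?)
open import Data.List using (List; []; _∷_; map; length; filter; cartesianProductWith; foldr)
import Data.List as List
open import Data.List.Membership.Propositional using (_∈_)
open import Data.List.Membership.Propositional.Properties using (∈-map⁺; ∈-map⁻; ∈-filter⁺; ∈-filter⁻; ∈-cartesianProductWith⁺)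
open import Data.List.Properties using (map-++; map-∘; map-cong; length-map)
open import Data.List.Relation.Unary.All using ([]; _∷_)
open import Data.List.Relation.Unary.AllPairs using ([]; _∷_)
open import Data.List.Relation.Unary.Any using (here; there)
open import Data.List.Relation.Unary.Unique.Propositional using (Unique)
import Data.List.Relation.Unary.Unique.Propositional.Properties as Unique
open import Data.Nat using (ℕ; zero; suc; _+_; _*_; _^_; _≤_; z≤n; s≤s; _≟_)
open import Data.Nat.ListAction using (sum)
open import Data.Nat.ListAction.Properties using (sum-++)
open import Data.Nat.Properties using (+-identityʳ; +-comm; *-zeroʳ; *-zeroˡ; *-distribˡ-+; *-distribʳ-+; +-commutativeSemigroup; +-mono-≤; +-cancelʳ-≡; ^-distribˡ-+-*; ^-zeroˡ)
open import Data.Nat.Tactic.RingSolver using (solve-∀)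
open import Algebra.Properties.CommutativeSemigroup +-commutativeSemigroup using () renaming (interchange to +-interchange)
open import Data.Product using (Σ; _×_; _,_; proj₁; proj₂)
open import Data.Sum using (_⊎_; inj₁; inj₂)
open import Data.Vec using (Vec; []; _∷_; lookup; tabulate; _++_)
open import Data.Vec.Properties using (lookup∘tabulate; tabulate∘lookup; tabulate-cong; ∷-injective; lookup-++ˡ; lookup-++ʳ)
open import Data.Vec.Relation.Unary.All as All using (All; all?; []; _∷_)
open import Data.Vec.Relation.Unary.All.Properties using (lookup⁺; lookup⁻)
open import Data.Vec.Relation.Unary.AllPairs using ([]; _∷_)
import Data.Vec.Relation.Unary.Unique.Propositional as Vec
open import Data.Vec.Relation.Unary.Unique.Propositional.Properties using (lookup-injective)
open import Function using (_∘_; _⇔_; _↔_; mk⇔; mk↔ₛ′; Inverse; Equivalence; Injection; Injective)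
open import Function.Construct.Composition using (_⇔-∘_)
open import Function.Construct.Symmetry using (⇔-sym)
open import Function.Properties.Inverse using (↔⇒↣)
open import Level using (0ℓ)
open import Relation.Binary.Definitions using (DecidableEquality)
open import Relation.Binary.PropositionalEquality using (_≡_; _≢_; refl; sym; trans; cong; cong₂; subst; subst₂; ≢-sym; module ≡-Reasoning)
open import Relation.Nullary using (¬_; Dec; yes; no; does; _because_; ¬?; _×-dec_; _⊎-dec_; _→-dec_; from-yes)
open import Relation.Nullary.Decidable using (map′; does-⇔)
open import Relation.Unary using (Pred; Decidable; _∩_)
open import Relation.Unary.Properties using (_∩?_; _∪?_)

_≟ᶜ_ : DecidableEquality Color
red   ≟ᶜ red   = yes refl
red   ≟ᶜ green = no λ ()
red   ≟ᶜ blue  = no λ ()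
green ≟ᶜ red   = no λ ()
green ≟ᶜ green = yes refl
green ≟ᶜ blue  = no λ ()
blue  ≟ᶜ red   = no λ ()
blue  ≟ᶜ green = no λ ()
blue  ≟ᶜ blue  = yes refl

avoid? : ∀ c → Decidable (_≢ c)
avoid? c x = ¬? (x ≟ᶜ c)

distinct3? : ∀ a b c → Dec (Distinct3 a b c)
distinct3? a b c = ¬? (a ≟ᶜ b) ×-dec ¬? (b ≟ᶜ c) ×-dec ¬? (a ≟ᶜ c)

∀ᶜ? : {P : Color → Set} → Decidable P → Dec (∀ c → P c)
∀ᶜ? P? = map′ (λ { (r , g , b) red → r ; (r , g , b) green → g ; (r , g , b) blue → b })
              (λ all → all red , all green , all blue)
              (P? red ×-dec P? green ×-dec P? blue)

distinct3-swapʳ : ∀ {a b c} → Distinct3 a b c → Distinct3 a c b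
distinct3-swapʳ (a≢b , b≢c , a≢c) = a≢c , ≢-sym b≢c , a≢b

distinct3-rotate : ∀ {a b c} → Distinct3 a b c → Distinct3 b c a
distinct3-rotate (a≢b , b≢c , a≢c) = b≢c , ≢-sym a≢c , ≢-sym a≢b

distinct3-reverse : ∀ {a b c} → Distinct3 a b c → Distinct3 c b a
distinct3-reverse (a≢b , b≢c , a≢c) = ≢-sym b≢c , ≢-sym a≢b , ≢-sym a≢c

¬distinct3-cong : ∀ {a b c a′ b′ c′} → a ≡ a′ → b ≡ b′ → c ≡ c′ → ¬ Distinct3 a b c → ¬ Distinct3 a′ b′ c′
¬distinct3-cong refl refl refl ¬rainbow = ¬rainbow

no-four-distinct-colours : ∀ {a b c d} → Distinct3 a b c → d ≢ a → d ≢ b → d ≢ c → ⊥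
no-four-distinct-colours {a} {b} {c} {d} = from-yes
  (∀ᶜ? λ a → ∀ᶜ? λ b → ∀ᶜ? λ c → ∀ᶜ? λ d →
    distinct3? a b c →-dec ¬? (d ≟ᶜ a) →-dec ¬? (d ≟ᶜ b) →-dec ¬? (d ≟ᶜ c) →-dec no λ ())
  a b c d

-- Extensions by a new vertex and their enumerations

Compatible : ∀ {n} → Coloring n → Vec Color n → Set
Compatible {n} φ f = (i j : Fin n) → i ≢ j → ¬ Distinct3 (lookup f i) (φ i j) (lookup f j)

compatible? : ∀ {n} (φ : Coloring n) → Decidable (Compatible φ)
compatible? φ f = ∀ᶠ? λ i → ∀ᶠ? λ j → ¬? (i ≟ᶠ j) →-dec ¬? (distinct3? _ _ _)

compatible-cong : ∀ {n} {φ ψ : Coloring n} → (∀ i j → i ≢ j → φ i j ≡ ψ i j) →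
  ∀ {f} → Compatible φ f → Compatible ψ f
compatible-cong φ≡ψ compatible i j i≢j rewrite sym (φ≡ψ i j i≢j) = compatible i j i≢j

gallai-extend⇔compatible : ∀ {n} {φ : Coloring n} → Gallai φ → ∀ f → Gallai (extend φ f) ⇔ Compatible φ f
gallai-extend⇔compatible {φ = φ} gallai f = mk⇔ to from
  where
  to : Gallai (extend φ f) → Compatible φ f
  to gallai⁺ i j i≢j = gallai⁺ zero (suc i) (suc j) (λ ()) (i≢j ∘ suc-injective) (λ ())

  from : Compatible φ f → Gallai (extend φ f)
  from compatible zero    zero    _       0≢0 _   _   _ = 0≢0 refl
  from compatible zero    (suc _) zero    _   _   0≢0 _ = 0≢0 refl
  from compatible zero    (suc j) (suc k) _   j≢k _     = compatible j k (j≢k ∘ cong suc)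
  from compatible (suc _) zero    zero    _   0≢0 _   _ = 0≢0 refl
  from compatible (suc i) zero    (suc k) _   _   i≢k   = compatible i k (i≢k ∘ cong suc) ∘ distinct3-swapʳ
  from compatible (suc i) (suc j) zero    i≢j _   _     =
    compatible i j (i≢j ∘ cong suc) ∘ distinct3-rotate ∘ distinct3-rotate
  from compatible (suc i) (suc j) (suc k) i≢j j≢k i≢k   =
    gallai i j k (i≢j ∘ cong suc) (j≢k ∘ cong suc) (i≢k ∘ cong suc)

Enumeration : {A : Set} → Pred A 0ℓ → ℕ → Set
Enumeration {A} P k = Σ (List A) λ xs → Unique xs × (∀ x → x ∈ xs ⇔ P x) × length xs ≡ k

enumeration-cong : ∀ {A : Set} {P Q : Pred A 0ℓ} {k} → (∀ x → P x ⇔ Q x) → Enumeration P k → Enumeration Q k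
enumeration-cong P⇔Q (xs , unique , ∈⇔P , len) = xs , unique , (λ x → P⇔Q x ⇔-∘ ∈⇔P x) , len

enumeration-map : ∀ {A B : Set} {P : Pred A 0ℓ} {Q : Pred B 0ℓ} {k} (h : A ↔ B) →
  (∀ x → P x ⇔ Q (Inverse.to h x)) → Enumeration P k → Enumeration Q k
enumeration-map {Q = Q} h P⇔Q (xs , unique , ∈⇔P , len) =
  map to xs , Unique.map⁺ (Injection.injective (↔⇒↣ h)) unique , (λ y → mk⇔ (sound y) (complete y)) ,
  trans (length-map to xs) len
  where
  open Inverse h using (to; from; strictlyInverseˡ)
  sound : ∀ y → y ∈ map to xs → Q y
  sound y y∈ with ∈-map⁻ to y∈
  ... | x , x∈xs , refl = Equivalence.to (P⇔Q x) (Equivalence.to (∈⇔P x) x∈xs)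
  complete : ∀ y → Q y → y ∈ map to xs
  complete y Qy = subst (_∈ map to xs) (strictlyInverseˡ y)
    (∈-map⁺ to (Equivalence.from (∈⇔P (from y))
      (Equivalence.from (P⇔Q (from y)) (subst Q (sym (strictlyInverseˡ y)) Qy))))

enumeration-filter : ∀ {A : Set} {P : Pred A 0ℓ} (P? : Decidable P) {xs} →
  Unique xs → (∀ x → x ∈ xs) → Enumeration P (length (filter P? xs))
enumeration-filter P? {xs} unique complete =
  filter P? xs , Unique.filter⁺ P? unique ,
  (λ x → mk⇔ (proj₂ ∘ ∈-filter⁻ P? {xs = xs}) (∈-filter⁺ P? (complete x))) , refl

-- Relabelling vertices

permutation-injective : ∀ {n} (σ : Permutation′ n) → Injective _≡_ _≡_ (σ ⟨$⟩ʳ_)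
permutation-injective σ = Injection.injective (↔⇒↣ σ)

relabel : ∀ {n} → Permutation′ n → Coloring n → Coloring n
relabel σ φ x y = φ (σ ⟨$⟩ʳ x) (σ ⟨$⟩ʳ y)

relabel-symmetric : ∀ {n} (σ : Permutation′ n) {φ} → Symmetric φ → Symmetric (relabel σ φ)
relabel-symmetric σ φ-sym x y = φ-sym (σ ⟨$⟩ʳ x) (σ ⟨$⟩ʳ y)

permute : ∀ {n} → Permutation′ n → Vec Color n → Vec Color n
permute σ f = tabulate (λ i → lookup f (σ ⟨$⟩ʳ i))

permute-flip : ∀ {n} (σ : Permutation′ n) f → permute σ (permute (flip σ) f) ≡ f
permute-flip σ f =
  trans (tabulate-cong λ i → trans (lookup∘tabulate _ (σ ⟨$⟩ʳ i)) (cong (lookup f) (inverseˡ σ)))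
        (tabulate∘lookup f)

permute-↔ : ∀ {n} → Permutation′ n → Vec Color n ↔ Vec Color n
permute-↔ σ = mk↔ₛ′ (permute σ) (permute (flip σ)) (permute-flip σ) (permute-flip (flip σ))

compatible-relabel : ∀ {n} (σ : Permutation′ n) {φ f} → Compatible φ f → Compatible (relabel σ φ) (permute σ f)
compatible-relabel σ {f = f} compatible x y x≢y
  rewrite lookup∘tabulate (λ i → lookup f (σ ⟨$⟩ʳ i)) x | lookup∘tabulate (λ i → lookup f (σ ⟨$⟩ʳ i)) y =
  compatible (σ ⟨$⟩ʳ x) (σ ⟨$⟩ʳ y) (x≢y ∘ permutation-injective σ)

compatible-relabel⇔ : ∀ {n} (σ : Permutation′ n) {φ} g →
  Compatible (relabel σ φ) g ⇔ Compatible φ (permute (flip σ) g)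
compatible-relabel⇔ σ {φ} g = mk⇔
  (compatible-cong (λ x y _ → cong₂ φ (inverseʳ σ) (inverseʳ σ)) {permute (flip σ) g} ∘ compatible-relabel (flip σ) {f = g})
  (subst (Compatible (relabel σ φ)) (permute-flip σ g) ∘ compatible-relabel σ {f = permute (flip σ) g})

hasWeight-relabel : ∀ {n} {φ : Coloring n} → Gallai φ → (σ : Permutation′ n) →
  ∀ {k} → Enumeration (Compatible (relabel σ φ)) k → HasWeight φ k
hasWeight-relabel gallai σ =
  enumeration-cong (⇔-sym ∘ gallai-extend⇔compatible gallai) ∘
  enumeration-map (permute-↔ (flip σ)) (compatible-relabel⇔ σ)

permutation-extending : ∀ {k m} (f : Fin k → Fin (k + m)) → Injective _≡_ _≡_ f →
  Σ (Permutation′ (k + m)) λ σ → ∀ i → σ ⟨$⟩ʳ (i ↑ˡ m) ≡ f i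
permutation-extending {zero}      f _           = id , λ ()
permutation-extending {suc k} {m} f f-injective = insert zero (f zero) σ , places
  where
  f₀≢f-suc : ∀ i → f zero ≢ f (suc i)
  f₀≢f-suc i = 0≢1+n ∘ f-injective
  f′ : Fin k → Fin (k + m)
  f′ i = punchOut (f₀≢f-suc i)
  f′-injective : Injective _≡_ _≡_ f′
  f′-injective {i} {j} eq = suc-injective (f-injective (punchOut-injective (f₀≢f-suc i) (f₀≢f-suc j) eq))
  σ : Permutation′ (k + m)
  σ = proj₁ (permutation-extending f′ f′-injective)
  places : ∀ i → insert zero (f zero) σ ⟨$⟩ʳ (i ↑ˡ m) ≡ f i
  places zero    = refl
  places (suc i) =
    trans (cong (punchIn (f zero)) (proj₂ (permutation-extending f′ f′-injective) i)) (punchIn-punchOut _)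

sameEdge-injective : ∀ {n} (σ : Permutation′ n) {x y a b} →
  SameEdge (σ ⟨$⟩ʳ x) (σ ⟨$⟩ʳ y) (σ ⟨$⟩ʳ a) (σ ⟨$⟩ʳ b) → SameEdge x y a b
sameEdge-injective σ (inj₁ (x≡a , y≡b)) = inj₁ (permutation-injective σ x≡a , permutation-injective σ y≡b)
sameEdge-injective σ (inj₂ (x≡b , y≡a)) = inj₂ (permutation-injective σ x≡b , permutation-injective σ y≡a)

¬sameEdgeˡ : ∀ {n} {x y a b : Fin n} → x ≢ a → x ≢ b → ¬ SameEdge x y a b
¬sameEdgeˡ x≢a x≢b (inj₁ (x≡a , _)) = x≢a x≡a
¬sameEdgeˡ x≢a x≢b (inj₂ (x≡b , _)) = x≢b x≡b

¬sameEdgeʳ : ∀ {n} {x y a b : Fin n} → y ≢ a → y ≢ b → ¬ SameEdge x y a b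
¬sameEdgeʳ y≢a y≢b (inj₁ (_ , y≡b)) = y≢b y≡b
¬sameEdgeʳ y≢a y≢b (inj₂ (_ , y≡a)) = y≢a y≡a

-- Counting colour vectors

sum-map-cong : ∀ {A : Set} {F G : A → ℕ} → (∀ x → F x ≡ G x) → ∀ xs → sum (map F xs) ≡ sum (map G xs)
sum-map-cong F≗G xs = cong sum (map-cong F≗G xs)

sum-map-+ : ∀ {A : Set} (F G : A → ℕ) xs → sum (map (λ x → F x + G x) xs) ≡ sum (map F xs) + sum (map G xs)
sum-map-+ F G []       = refl
sum-map-+ F G (x ∷ xs) = trans (cong (F x + G x +_) (sum-map-+ F G xs)) (+-interchange (F x) (G x) _ _)

sum-map-*ˡ : ∀ {A : Set} a (F : A → ℕ) xs → sum (map (λ x → a * F x) xs) ≡ a * sum (map F xs)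
sum-map-*ˡ a F []       = sym (*-zeroʳ a)
sum-map-*ˡ a F (x ∷ xs) = trans (cong (a * F x +_) (sum-map-*ˡ a F xs)) (sym (*-distribˡ-+ a (F x) _))

sum-map-*ʳ : ∀ {A : Set} a (F : A → ℕ) xs → sum (map (λ x → F x * a) xs) ≡ sum (map F xs) * a
sum-map-*ʳ a F []       = refl
sum-map-*ʳ a F (x ∷ xs) = trans (cong (F x * a +_) (sum-map-*ʳ a F xs)) (sym (*-distribʳ-+ a (F x) _))

sum-map-cartesianProductWith : ∀ {A B C : Set} (F : C → ℕ) (f : A → B → C) xs ys →
  sum (map F (cartesianProductWith f xs ys)) ≡ sum (map (λ x → sum (map (λ y → F (f x y)) ys)) xs)
sum-map-cartesianProductWith F f []       ys = refl
sum-map-cartesianProductWith F f (x ∷ xs) ys = begin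
  sum (map F (map (f x) ys List.++ cartesianProductWith f xs ys))
    ≡⟨ cong sum (map-++ F (map (f x) ys) _) ⟩
  sum (map F (map (f x) ys) List.++ map F (cartesianProductWith f xs ys))
    ≡⟨ sum-++ (map F (map (f x) ys)) _ ⟩
  sum (map F (map (f x) ys)) + sum (map F (cartesianProductWith f xs ys))
    ≡⟨ cong₂ _+_ (cong sum (sym (map-∘ ys))) (sum-map-cartesianProductWith F f xs ys) ⟩
  sum (map (λ y → F (f x y)) ys) + sum (map (λ x → sum (map (λ y → F (f x y)) ys)) xs)
    ∎
  where open ≡-Reasoning

colours : List Color
colours = red ∷ green ∷ blue ∷ []

allVecs : ∀ m → List (Vec Color m)
allVecs zero    = [] ∷ []
allVecs (suc m) = cartesianProductWith _∷_ colours (allVecs m)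

allVecs-complete : ∀ {m} (f : Vec Color m) → f ∈ allVecs m
allVecs-complete []      = here refl
allVecs-complete (c ∷ f) = ∈-cartesianProductWith⁺ _∷_ (colour∈colours c) (allVecs-complete f)
  where
  colour∈colours : ∀ c → c ∈ colours
  colour∈colours red   = here refl
  colour∈colours green = there (here refl)
  colour∈colours blue  = there (there (here refl))

allVecs-unique : ∀ m → Unique (allVecs m)
allVecs-unique zero    = [] ∷ []
allVecs-unique (suc m) = Unique.cartesianProductWith⁺ _∷_ ∷-injective colours-unique (allVecs-unique m)
  where
  colours-unique : Unique colours
  colours-unique = ((λ ()) ∷ (λ ()) ∷ []) ∷ ((λ ()) ∷ []) ∷ [] ∷ []

Σᶜ : (Color → ℕ) → ℕ
Σᶜ F = sum (map F colours)

Σᵛ : ∀ m → (Vec Color m → ℕ) → ℕ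
Σᵛ m F = sum (map F (allVecs m))

Σᵛ-suc : ∀ m (F : Vec Color (suc m) → ℕ) → Σᵛ (suc m) F ≡ Σᶜ λ c → Σᵛ m λ t → F (c ∷ t)
Σᵛ-suc m F = sum-map-cartesianProductWith F _∷_ colours (allVecs m)

Σᵛ-++ : ∀ k {m} (F : Vec Color (k + m) → ℕ) → Σᵛ (k + m) F ≡ Σᵛ k λ g → Σᵛ m λ t → F (g ++ t)
Σᵛ-++ zero    F = sym (+-identityʳ _)
Σᵛ-++ (suc k) F = begin
  Σᵛ (suc k + _) F                                   ≡⟨ Σᵛ-suc _ F ⟩
  (Σᶜ λ c → Σᵛ (k + _) λ t → F (c ∷ t))              ≡⟨ sum-map-cong (λ c → Σᵛ-++ k λ t → F (c ∷ t)) colours ⟩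
  (Σᶜ λ c → Σᵛ k λ g → Σᵛ _ λ t → F (c ∷ g ++ t))    ≡⟨ Σᵛ-suc k _ ⟨
  (Σᵛ (suc k) λ g → Σᵛ _ λ t → F (g ++ t))           ∎
  where open ≡-Reasoning

𝟙 : ∀ {P : Set} → Dec P → ℕ
𝟙 P? = if does P? then 1 else 0

𝟙-× : ∀ {P Q : Set} (P? : Dec P) (Q? : Dec Q) → 𝟙 (P? ×-dec Q?) ≡ 𝟙 P? * 𝟙 Q?
𝟙-× (true  because _) Q? = sym (+-identityʳ (𝟙 Q?))
𝟙-× (false because _) Q? = refl

𝟙-⊎-× : ∀ {P Q : Set} (P? : Dec P) (Q? : Dec Q) → 𝟙 (P? ⊎-dec Q?) + 𝟙 (P? ×-dec Q?) ≡ 𝟙 P? + 𝟙 Q?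
𝟙-⊎-× (true  because _) Q? = refl
𝟙-⊎-× (false because _) Q? = +-identityʳ (𝟙 Q?)

𝟙≤1 : ∀ {P : Set} (P? : Dec P) → 𝟙 P? ≤ 1
𝟙≤1 (true  because _) = s≤s z≤n
𝟙≤1 (false because _) = z≤n

∣_∣ : {P : Pred Color 0ℓ} → Decidable P → ℕ
∣ P? ∣ = Σᶜ (𝟙 ∘ P?)

∣∣≤3 : ∀ {P : Pred Color 0ℓ} (P? : Decidable P) → ∣ P? ∣ ≤ 3
∣∣≤3 P? = +-mono-≤ (𝟙≤1 (P? red)) (+-mono-≤ (𝟙≤1 (P? green)) (+-mono-≤ (𝟙≤1 (P? blue)) z≤n))

count : ∀ {m} {P : Pred (Vec Color m) 0ℓ} → Decidable P → ℕ
count {m} P? = Σᵛ m (𝟙 ∘ P?)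

length-filter-allVecs : ∀ {m} {P : Pred (Vec Color m) 0ℓ} (P? : Decidable P) →
  length (filter P? (allVecs m)) ≡ count P?
length-filter-allVecs {m} P? = length-filter (allVecs m)
  where
  length-filter : ∀ xs → length (filter P? xs) ≡ sum (map (𝟙 ∘ P?) xs)
  length-filter []       = refl
  length-filter (x ∷ xs) with P? x
  ... | yes _ = cong suc (length-filter xs)
  ... | no  _ = length-filter xs

count-cong : ∀ {m} {P Q : Pred (Vec Color m) 0ℓ} (P? : Decidable P) (Q? : Decidable Q) →
  (∀ f → P f ⇔ Q f) → count P? ≡ count Q?
count-cong {m} P? Q? P⇔Q =
  sum-map-cong (λ f → cong (λ b → if b then 1 else 0) (does-⇔ (P⇔Q f) (P? f) (Q? f))) (allVecs m)

count-∪-∩ : ∀ {m} {P Q : Pred (Vec Color m) 0ℓ} (P? : Decidable P) (Q? : Decidable Q) →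
  count (P? ∪? Q?) + count (P? ∩? Q?) ≡ count P? + count Q?
count-∪-∩ {m} P? Q? = begin
  count (P? ∪? Q?) + count (P? ∩? Q?)
    ≡⟨ sum-map-+ (𝟙 ∘ (P? ∪? Q?)) (𝟙 ∘ (P? ∩? Q?)) (allVecs m) ⟨
  sum (map (λ f → 𝟙 (P? f ⊎-dec Q? f) + 𝟙 (P? f ×-dec Q? f)) (allVecs m))
    ≡⟨ sum-map-cong (λ f → 𝟙-⊎-× (P? f) (Q? f)) (allVecs m) ⟩
  sum (map (λ f → 𝟙 (P? f) + 𝟙 (Q? f)) (allVecs m))
    ≡⟨ sum-map-+ (𝟙 ∘ P?) (𝟙 ∘ Q?) (allVecs m) ⟩
  count P? + count Q?
    ∎
  where open ≡-Reasoning

count-const-× : ∀ {m} {X : Set} {Q : Pred (Vec Color m) 0ℓ} (X? : Dec X) (Q? : Decidable Q) →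
  count (λ t → X? ×-dec Q? t) ≡ 𝟙 X? * count Q?
count-const-× {m} X? Q? =
  trans (sum-map-cong (λ t → 𝟙-× X? (Q? t)) (allVecs m)) (sum-map-*ˡ (𝟙 X?) _ (allVecs m))

count-all : ∀ m {A : Pred Color 0ℓ} (A? : Decidable A) → count (all? {n = m} A?) ≡ ∣ A? ∣ ^ m
count-all zero    A?     = refl
count-all (suc m) {A} A? = begin
  count (all? {n = suc m} A?)                 ≡⟨ Σᵛ-suc m (𝟙 ∘ all? A?) ⟩
  (Σᶜ λ c → count λ t → A? c ×-dec all-A? t)  ≡⟨ sum-map-cong (λ c → count-const-× (A? c) all-A?) colours ⟩
  (Σᶜ λ c → 𝟙 (A? c) * count all-A?)         ≡⟨ sum-map-*ʳ (count all-A?) (𝟙 ∘ A?) colours ⟩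
  ∣ A? ∣ * count all-A?                       ≡⟨ cong (∣ A? ∣ *_) (count-all m A?) ⟩
  ∣ A? ∣ ^ suc m                              ∎
  where
  open ≡-Reasoning
  all-A? : Decidable (λ (t : Vec Color m) → All A t)
  all-A? = all? A?

count-++ : ∀ k {m} {P : Pred (Vec Color (k + m)) 0ℓ} (P? : Decidable P) →
  count P? ≡ Σᵛ k λ g → count λ t → P? (g ++ t)
count-++ k P? = Σᵛ-++ k (𝟙 ∘ P?)

record PowerSum : Set where
  constructor ⟨_,_,_,_⟩
  field c₀ c₁ c₂ c₃ : ℕ

⟦_⟧ : PowerSum → ℕ → ℕ
⟦ ⟨ a , b , c , d ⟩ ⟧ m = a * 0 ^ m + b * 1 ^ m + c * 2 ^ m + d * 3 ^ m

0ᴾ : PowerSum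
0ᴾ = ⟨ 0 , 0 , 0 , 0 ⟩

infixl 6 _⊕_
_⊕_ : PowerSum → PowerSum → PowerSum
⟨ a , b , c , d ⟩ ⊕ ⟨ a′ , b′ , c′ , d′ ⟩ = ⟨ a + a′ , b + b′ , c + c′ , d + d′ ⟩

infix 4 _≟ᴾ_
_≟ᴾ_ : DecidableEquality PowerSum
⟨ a , b , c , d ⟩ ≟ᴾ ⟨ a′ , b′ , c′ , d′ ⟩ =
  map′ (λ { (refl , refl , refl , refl) → refl }) (λ { refl → refl , refl , refl , refl })
       (a ≟ a′ ×-dec b ≟ b′ ×-dec c ≟ c′ ×-dec d ≟ d′)

⟦⟧-⊕ : ∀ x y m → ⟦ x ⊕ y ⟧ m ≡ ⟦ x ⟧ m + ⟦ y ⟧ m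
⟦⟧-⊕ ⟨ a , b , c , d ⟩ ⟨ a′ , b′ , c′ , d′ ⟩ m = linear a b c d a′ b′ c′ d′ (0 ^ m) (1 ^ m) (2 ^ m) (3 ^ m)
  where
  linear : ∀ a b c d a′ b′ c′ d′ x y z w →
    (a + a′) * x + (b + b′) * y + (c + c′) * z + (d + d′) * w ≡
    (a * x + b * y + c * z + d * w) + (a′ * x + b′ * y + c′ * z + d′ * w)
  linear = solve-∀

monomial : ℕ → PowerSum
monomial 0 = ⟨ 1 , 0 , 0 , 0 ⟩
monomial 1 = ⟨ 0 , 1 , 0 , 0 ⟩
monomial 2 = ⟨ 0 , 0 , 1 , 0 ⟩
monomial 3 = ⟨ 0 , 0 , 0 , 1 ⟩
monomial _ = 0ᴾ

⟦monomial⟧ : ∀ {s} → s ≤ 3 → ∀ m → ⟦ monomial s ⟧ m ≡ s ^ m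
⟦monomial⟧ z≤n                   m = unit (0 ^ m) (1 ^ m) (2 ^ m) (3 ^ m)
  where unit : ∀ x y z w → 1 * x + 0 * y + 0 * z + 0 * w ≡ x
        unit = solve-∀
⟦monomial⟧ (s≤s z≤n)             m = unit (0 ^ m) (1 ^ m) (2 ^ m) (3 ^ m)
  where unit : ∀ x y z w → 0 * x + 1 * y + 0 * z + 0 * w ≡ y
        unit = solve-∀
⟦monomial⟧ (s≤s (s≤s z≤n))       m = unit (0 ^ m) (1 ^ m) (2 ^ m) (3 ^ m)
  where unit : ∀ x y z w → 0 * x + 0 * y + 1 * z + 0 * w ≡ z
        unit = solve-∀
⟦monomial⟧ (s≤s (s≤s (s≤s z≤n))) m = unit (0 ^ m) (1 ^ m) (2 ^ m) (3 ^ m)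
  where unit : ∀ x y z w → 0 * x + 0 * y + 0 * z + 1 * w ≡ w
        unit = solve-∀

when : ∀ {P : Set} → Dec P → PowerSum → PowerSum
when P? x = if does P? then x else 0ᴾ

⟦when⟧ : ∀ {P : Set} (P? : Dec P) x m → ⟦ when P? x ⟧ m ≡ 𝟙 P? * ⟦ x ⟧ m
⟦when⟧ (true  because _) x m = sym (+-identityʳ (⟦ x ⟧ m))
⟦when⟧ (false because _) x m = refl

Σᴾ : ∀ k → (Vec Color k → PowerSum) → PowerSum
Σᴾ k F = foldr _⊕_ 0ᴾ (map F (allVecs k))

⟦Σᴾ⟧ : ∀ k F m → ⟦ Σᴾ k F ⟧ m ≡ Σᵛ k λ g → ⟦ F g ⟧ m
⟦Σᴾ⟧ k F m = go (allVecs k)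
  where
  go : ∀ gs → ⟦ foldr _⊕_ 0ᴾ (map F gs) ⟧ m ≡ sum (map (λ g → ⟦ F g ⟧ m) gs)
  go []       = refl
  go (g ∷ gs) = trans (⟦⟧-⊕ (F g) _ m) (cong (⟦ F g ⟧ m +_) (go gs))

cancel-excess : ∀ {N} k m x z → N + ⟦ x ⟧ m ≡ ⟦ x ⊕ ⟨ z , 3 , 2 ^ k , 0 ⟩ ⟧ m → z * 0 ^ m ≡ 0 →
  N ≡ 2 ^ (k + m) + 3
cancel-excess {N} k m x z excess z0ᵐ≡0 = +-cancelʳ-≡ (⟦ x ⟧ m) N (2 ^ (k + m) + 3) (begin
  N + ⟦ x ⟧ m                                            ≡⟨ excess ⟩
  ⟦ x ⊕ ⟨ z , 3 , 2 ^ k , 0 ⟩ ⟧ m                         ≡⟨ ⟦⟧-⊕ x _ m ⟩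
  ⟦ x ⟧ m + (z * 0 ^ m + 3 * 1 ^ m + 2 ^ k * 2 ^ m + 0)    ≡⟨ cong (⟦ x ⟧ m +_) (reorder (z * 0 ^ m) (1 ^ m) (2 ^ k * 2 ^ m)) ⟩
  ⟦ x ⟧ m + (z * 0 ^ m + 2 ^ k * 2 ^ m + 3 * 1 ^ m)        ≡⟨ cong (λ y → ⟦ x ⟧ m + (y + 2 ^ k * 2 ^ m + 3 * 1 ^ m)) z0ᵐ≡0 ⟩
  ⟦ x ⟧ m + (2 ^ k * 2 ^ m + 3 * 1 ^ m)                  ≡⟨ cong₂ (λ a b → ⟦ x ⟧ m + (a + 3 * b)) (sym (^-distribˡ-+-* 2 k m)) (^-zeroˡ m) ⟩
  ⟦ x ⟧ m + (2 ^ (k + m) + 3)                            ≡⟨ +-comm (⟦ x ⟧ m) _ ⟩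
  2 ^ (k + m) + 3 + ⟦ x ⟧ m                              ∎)
  where
  open ≡-Reasoning
  reorder : ∀ a b c → a + 3 * b + c + 0 ≡ a + c + 3 * b
  reorder = solve-∀

-- Monochromatic tails and cones

compatible-monochromatic⇔ : ∀ {m p e q} → Distinct3 p e q → (t : Vec Color m) →
  Compatible (λ _ _ → e) t ⇔ (All (_≢ p) t ⊎ All (_≢ q) t)
compatible-monochromatic⇔ {p = p} {e} {q} (p≢e , e≢q , p≢q) t = mk⇔ to from
  where
  to : Compatible (λ _ _ → e) t → All (_≢ p) t ⊎ All (_≢ q) t
  to compatible with any? (λ i → lookup t i ≟ᶜ p) | any? (λ j → lookup t j ≟ᶜ q)
  ... | no no-p        | _              = inj₁ (lookup⁻ λ i tᵢ≡p → no-p (i , tᵢ≡p))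
  ... | yes _          | no no-q        = inj₂ (lookup⁻ λ j tⱼ≡q → no-q (j , tⱼ≡q))
  ... | yes (i , tᵢ≡p) | yes (j , tⱼ≡q) =
    ⊥-elim (compatible i j i≢j (subst₂ (λ x y → Distinct3 x e y) (sym tᵢ≡p) (sym tⱼ≡q) (p≢e , e≢q , p≢q)))
    where
    i≢j : i ≢ j
    i≢j refl = p≢q (trans (sym tᵢ≡p) tⱼ≡q)

  from : All (_≢ p) t ⊎ All (_≢ q) t → Compatible (λ _ _ → e) t
  from (inj₁ avoids-p) i j _ rainbow =
    no-four-distinct-colours rainbow (≢-sym (lookup⁺ avoids-p i)) p≢e (≢-sym (lookup⁺ avoids-p j))
  from (inj₂ avoids-q) i j _ rainbow =
    no-four-distinct-colours rainbow (≢-sym (lookup⁺ avoids-q i)) (≢-sym e≢q) (≢-sym (lookup⁺ avoids-q j))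

all-compatible-monochromatic⇔ : ∀ {m p e q} → Distinct3 p e q → {A : Pred Color 0ℓ} (t : Vec Color m) →
  (All A t × Compatible (λ _ _ → e) t) ⇔ (All (A ∩ (_≢ p)) t ⊎ All (A ∩ (_≢ q)) t)
all-compatible-monochromatic⇔ {p = p} {e} {q} peq {A} t = mk⇔ to from
  where
  open Equivalence (compatible-monochromatic⇔ peq t) renaming (to to avoids; from to avoids⁻¹)
  to : All A t × Compatible (λ _ _ → e) t → All (A ∩ (_≢ p)) t ⊎ All (A ∩ (_≢ q)) t
  to (all-A , compatible) with avoids compatible
  ... | inj₁ avoids-p = inj₁ (All.zip (all-A , avoids-p))
  ... | inj₂ avoids-q = inj₂ (All.zip (all-A , avoids-q))
  from : All (A ∩ (_≢ p)) t ⊎ All (A ∩ (_≢ q)) t → All A t × Compatible (λ _ _ → e) t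
  from (inj₁ all-A∖p) = let all-A , avoids-p = All.unzip all-A∖p in all-A , avoids⁻¹ (inj₁ avoids-p)
  from (inj₂ all-A∖q) = let all-A , avoids-q = All.unzip all-A∖q in all-A , avoids⁻¹ (inj₂ avoids-q)

count-monochromatic : ∀ m {p e q} → Distinct3 p e q → {A : Pred Color 0ℓ} (A? : Decidable A) →
  count (all? {n = m} A? ∩? compatible? (λ _ _ → e)) + ∣ (A? ∩? avoid? p) ∩? (A? ∩? avoid? q) ∣ ^ m
    ≡ ∣ A? ∩? avoid? p ∣ ^ m + ∣ A? ∩? avoid? q ∣ ^ m
count-monochromatic m {p} {e} {q} peq {A} A? = begin
  count (allₘ? A? ∩? compatible? (λ _ _ → e)) + ∣ A∖p? ∩? A∖q? ∣ ^ m
    ≡⟨ cong₂ _+_ (count-cong (allₘ? A? ∩? compatible? (λ _ _ → e)) (allₘ? A∖p? ∪? allₘ? A∖q?)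
                              (all-compatible-monochromatic⇔ peq))
                 (trans (sym (count-all m (A∖p? ∩? A∖q?)))
                        (count-cong (allₘ? (A∖p? ∩? A∖q?)) (allₘ? A∖p? ∩? allₘ? A∖q?) (λ t → mk⇔ All.unzip All.zip))) ⟩
  count (allₘ? A∖p? ∪? allₘ? A∖q?) + count (allₘ? A∖p? ∩? allₘ? A∖q?)
    ≡⟨ count-∪-∩ (allₘ? A∖p?) (allₘ? A∖q?) ⟩
  count (allₘ? A∖p?) + count (allₘ? A∖q?)
    ≡⟨ cong₂ _+_ (count-all m A∖p?) (count-all m A∖q?) ⟩
  ∣ A∖p? ∣ ^ m + ∣ A∖q? ∣ ^ m
    ∎
  where
  open ≡-Reasoning
  allₘ? : ∀ {P : Pred Color 0ℓ} → Decidable P → Decidable (λ (t : Vec Color m) → All P t)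
  allₘ? = all?
  A∖p? : Decidable (A ∩ (_≢ p))
  A∖p? = A? ∩? avoid? p
  A∖q? : Decidable (A ∩ (_≢ q))
  A∖q? = A? ∩? avoid? q

data HeadOrTail k m : Fin (k + m) → Set where
  head : ∀ h → HeadOrTail k m (h ↑ˡ m)
  tail : ∀ t → HeadOrTail k m (k ↑ʳ t)

headOrTail : ∀ k {m} i → HeadOrTail k m i
headOrTail zero    t       = tail t
headOrTail (suc k) zero    = head zero
headOrTail (suc k) (suc i) with headOrTail k i
... | head h = head (suc h)
... | tail t = tail t

↑ˡ≢↑ʳ : ∀ {k m} (h : Fin k) (t : Fin m) → h ↑ˡ m ≢ k ↑ʳ t
↑ˡ≢↑ʳ zero    t ()
↑ˡ≢↑ʳ (suc h) t = ↑ˡ≢↑ʳ h t ∘ suc-injective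

record IsCone {k m} (ψ : Coloring (k + m)) (H : Coloring k) (ρ : Fin k → Color) (e : Color) : Set where
  field
    on-head : ∀ h h′ → h ≢ h′ → ψ (h ↑ˡ m) (h′ ↑ˡ m) ≡ H h h′
    on-link : ∀ h t → ψ (h ↑ˡ m) (k ↑ʳ t) ≡ ρ h
    on-tail : ∀ t t′ → t ≢ t′ → ψ (k ↑ʳ t) (k ↑ʳ t′) ≡ e

Allowed : ∀ {k} → (Fin k → Color) → Vec Color k → Pred Color 0ℓ
Allowed ρ g c = ∀ h → ¬ Distinct3 (lookup g h) (ρ h) c

allowed? : ∀ {k} (ρ : Fin k → Color) g → Decidable (Allowed ρ g)
allowed? ρ g c = ∀ᶠ? λ h → ¬? (distinct3? _ _ _)

compatible-cone⇔ : ∀ {k m} {ψ : Coloring (k + m)} {H ρ e} → Symmetric ψ → IsCone ψ H ρ e → ∀ g t →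
  Compatible ψ (g ++ t) ⇔ (Compatible H g × (All (Allowed ρ g) t × Compatible (λ _ _ → e) t))
compatible-cone⇔ {k} {m} {ψ} {H} {ρ} {e} ψ-sym cone g t = mk⇔ to from
  where
  open IsCone cone

  to : Compatible ψ (g ++ t) → Compatible H g × (All (Allowed ρ g) t × Compatible (λ _ _ → e) t)
  to compatible = within-head , lookup⁻ across , within-tail
    where
    within-head : Compatible H g
    within-head h h′ h≢h′ = ¬distinct3-cong (lookup-++ˡ g t h) (on-head h h′ h≢h′) (lookup-++ˡ g t h′)
      (compatible (h ↑ˡ m) (h′ ↑ˡ m) (h≢h′ ∘ ↑ˡ-injective m h h′))
    across : ∀ i → Allowed ρ g (lookup t i)
    across i h = ¬distinct3-cong (lookup-++ˡ g t h) (on-link h i) (lookup-++ʳ g t i)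
      (compatible (h ↑ˡ m) (k ↑ʳ i) (↑ˡ≢↑ʳ h i))
    within-tail : Compatible (λ _ _ → e) t
    within-tail i j i≢j = ¬distinct3-cong (lookup-++ʳ g t i) (on-tail i j i≢j) (lookup-++ʳ g t j)
      (compatible (k ↑ʳ i) (k ↑ʳ j) (i≢j ∘ ↑ʳ-injective k i j))

  from : Compatible H g × (All (Allowed ρ g) t × Compatible (λ _ _ → e) t) → Compatible ψ (g ++ t)
  from (within-head , allowed , within-tail) x y x≢y with headOrTail k x | headOrTail k y
  ... | head h | head h′ = ¬distinct3-cong (sym (lookup-++ˡ g t h)) (sym (on-head h h′ (x≢y ∘ cong (_↑ˡ m))))
    (sym (lookup-++ˡ g t h′)) (within-head h h′ (x≢y ∘ cong (_↑ˡ m)))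
  ... | head h | tail j  = ¬distinct3-cong (sym (lookup-++ˡ g t h)) (sym (on-link h j)) (sym (lookup-++ʳ g t j))
    (lookup⁺ allowed j h)
  ... | tail i | head h  = ¬distinct3-cong (sym (lookup-++ʳ g t i)) (sym (trans (ψ-sym _ _) (on-link h i)))
    (sym (lookup-++ˡ g t h)) (lookup⁺ allowed i h ∘ distinct3-reverse)
  ... | tail i | tail j  = ¬distinct3-cong (sym (lookup-++ʳ g t i)) (sym (on-tail i j (x≢y ∘ cong (k ↑ʳ_))))
    (sym (lookup-++ʳ g t j)) (within-tail i j (x≢y ∘ cong (k ↑ʳ_)))

-- Summed over the heads g compatible with H: the two inclusion–exclusion terms |S∖p|^m + |S∖q|^m
-- and |S∖p∖q|^m of the tail count, S the colours allowed by g.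
module _ {k} (H : Coloring k) (ρ : Fin k → Color) (p q : Color) where

  avoidingOneAt avoidingBothAt : Vec Color k → PowerSum
  avoidingOneAt g =
    when (compatible? H g) (monomial ∣ allowed? ρ g ∩? avoid? p ∣ ⊕ monomial ∣ allowed? ρ g ∩? avoid? q ∣)
  avoidingBothAt g =
    when (compatible? H g) (monomial ∣ (allowed? ρ g ∩? avoid? p) ∩? (allowed? ρ g ∩? avoid? q) ∣)

  avoidingOne avoidingBoth : PowerSum
  avoidingOne  = Σᴾ k avoidingOneAt
  avoidingBoth = Σᴾ k avoidingBothAt

count-cone : ∀ k {m} {ψ : Coloring (k + m)} {H ρ e p q} → Symmetric ψ → IsCone ψ H ρ e → Distinct3 p e q →
  count (compatible? ψ) + ⟦ avoidingBoth H ρ p q ⟧ m ≡ ⟦ avoidingOne H ρ p q ⟧ m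
count-cone k {m} {ψ} {H} {ρ} {e} {p} {q} ψ-sym cone peq = begin
  count (compatible? ψ) + ⟦ avoidingBoth H ρ p q ⟧ m
    ≡⟨ cong₂ _+_ (count-++ k (compatible? ψ)) (⟦Σᴾ⟧ k both m) ⟩
  (Σᵛ k λ g → count λ t → compatible? ψ (g ++ t)) + (Σᵛ k λ g → ⟦ both g ⟧ m)
    ≡⟨ sum-map-+ (λ g → count λ t → compatible? ψ (g ++ t)) (λ g → ⟦ both g ⟧ m) (allVecs k) ⟨
  (Σᵛ k λ g → count (λ t → compatible? ψ (g ++ t)) + ⟦ both g ⟧ m)
    ≡⟨ sum-map-cong per-head (allVecs k) ⟩
  (Σᵛ k λ g → ⟦ one g ⟧ m)
    ≡⟨ ⟦Σᴾ⟧ k one m ⟨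
  ⟦ avoidingOne H ρ p q ⟧ m
    ∎
  where
  open ≡-Reasoning
  one both : Vec Color k → PowerSum
  one  = avoidingOneAt H ρ p q
  both = avoidingBothAt H ρ p q

  pow : ∀ {P : Pred Color 0ℓ} (P? : Decidable P) → ⟦ monomial ∣ P? ∣ ⟧ m ≡ ∣ P? ∣ ^ m
  pow P? = ⟦monomial⟧ (∣∣≤3 P?) m

  per-head : ∀ g → count (λ t → compatible? ψ (g ++ t)) + ⟦ both g ⟧ m ≡ ⟦ one g ⟧ m
  per-head g = begin
    count (λ t → compatible? ψ (g ++ t)) + ⟦ both g ⟧ m
      ≡⟨ cong₂ _+_ (count-cong (λ t → compatible? ψ (g ++ t)) (λ t → H? ×-dec tail? t) (compatible-cone⇔ ψ-sym cone g))
                   (⟦when⟧ H? _ m) ⟩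
    count (λ t → H? ×-dec tail? t) + 𝟙 H? * ⟦ monomial ∣ S∖p? ∩? S∖q? ∣ ⟧ m
      ≡⟨ cong₂ _+_ (count-const-× H? tail?) (cong (𝟙 H? *_) (pow (S∖p? ∩? S∖q?))) ⟩
    𝟙 H? * count tail? + 𝟙 H? * ∣ S∖p? ∩? S∖q? ∣ ^ m
      ≡⟨ *-distribˡ-+ (𝟙 H?) _ _ ⟨
    𝟙 H? * (count tail? + ∣ S∖p? ∩? S∖q? ∣ ^ m)
      ≡⟨ cong (𝟙 H? *_) (count-monochromatic m peq (allowed? ρ g)) ⟩
    𝟙 H? * (∣ S∖p? ∣ ^ m + ∣ S∖q? ∣ ^ m)
      ≡⟨ cong (𝟙 H? *_) (trans (⟦⟧-⊕ (monomial ∣ S∖p? ∣) (monomial ∣ S∖q? ∣) m) (cong₂ _+_ (pow S∖p?) (pow S∖q?))) ⟨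
    𝟙 H? * ⟦ monomial ∣ S∖p? ∣ ⊕ monomial ∣ S∖q? ∣ ⟧ m
      ≡⟨ ⟦when⟧ H? _ m ⟨
    ⟦ one g ⟧ m
      ∎
    where
    H? : Dec (Compatible H g)
    H? = compatible? H g
    S∖p? : Decidable (Allowed ρ g ∩ (_≢ p))
    S∖p? = allowed? ρ g ∩? avoid? p
    S∖q? : Decidable (Allowed ρ g ∩ (_≢ q))
    S∖q? = allowed? ρ g ∩? avoid? q
    tail? : Decidable (λ t → All (Allowed ρ g) t × Compatible (λ _ _ → e) t)
    tail? = all? (allowed? ρ g) ∩? compatible? (λ _ _ → e)

hasWeight-cone : ∀ k {m} {φ : Coloring (k + m)} {H ρ e p q z} → Symmetric φ → Gallai φ →
  (σ : Permutation′ (k + m)) → IsCone (relabel σ φ) H ρ e → Distinct3 p e q →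
  avoidingOne H ρ p q ≡ avoidingBoth H ρ p q ⊕ ⟨ z , 3 , 2 ^ k , 0 ⟩ → z * 0 ^ m ≡ 0 →
  HasWeight φ (2 ^ (k + m) + 3)
hasWeight-cone k {m} {φ} {H} {ρ} {p = p} {q} {z} φ-sym gallai σ cone peq excess z0ᵐ≡0 =
  hasWeight-relabel gallai σ (subst (Enumeration (Compatible ψ)) count≡ enumeration)
  where
  ψ : Coloring (k + m)
  ψ = relabel σ φ
  enumeration : Enumeration (Compatible ψ) (count (compatible? ψ))
  enumeration = subst (Enumeration (Compatible ψ)) (length-filter-allVecs (compatible? ψ))
    (enumeration-filter (compatible? ψ) (allVecs-unique (k + m)) allVecs-complete)
  count≡ : count (compatible? ψ) ≡ 2 ^ (k + m) + 3
  count≡ = cancel-excess k m (avoidingBoth H ρ p q) z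
    (trans (count-cone k (relabel-symmetric σ φ-sym) cone peq) (cong (λ x → ⟦ x ⟧ m) excess)) z0ᵐ≡0

-- Special colourings in standard position

vertexHead : Color → Color → Color → Coloring 3
vertexHead c₀ c₁ c₂ zero             _                = c₀
vertexHead c₀ c₁ c₂ _                zero             = c₀
vertexHead c₀ c₁ c₂ (suc zero)       (suc (suc zero)) = c₂
vertexHead c₀ c₁ c₂ (suc (suc zero)) (suc zero)       = c₂
vertexHead c₀ c₁ c₂ _                _                = c₁

vertexLinks : Color → Color → Fin 3 → Color
vertexLinks c₀ c₁ zero    = c₀
vertexLinks c₀ c₁ (suc _) = c₁

vertexSpecial-isCone : ∀ {m} {φ : Coloring (3 + m)} → Symmetric φ → (σ : Permutation′ (3 + m)) →
  ∀ {v a b c₀ c₁ c₂} → σ ⟨$⟩ʳ zero ≡ v → σ ⟨$⟩ʳ suc zero ≡ a → σ ⟨$⟩ʳ suc (suc zero) ≡ b →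
  (∀ x → x ≢ v → φ v x ≡ c₀) → φ a b ≡ c₂ →
  (∀ x y → x ≢ y → x ≢ v → y ≢ v → ¬ SameEdge x y a b → φ x y ≡ c₁) →
  IsCone (relabel σ φ) (vertexHead c₀ c₁ c₂) (vertexLinks c₀ c₁) c₁
vertexSpecial-isCone {m} {φ} φ-sym σ {c₀ = c₀} {c₁} {c₂} refl refl refl apex base rest = record
  { on-head = on-head ; on-link = on-link ; on-tail = on-tail }
  where
  ψ : Coloring (3 + m)
  ψ = relabel σ φ
  ψ-sym : Symmetric ψ
  ψ-sym = relabel-symmetric σ φ-sym

  ψ-apex : ∀ y → y ≢ zero → ψ zero y ≡ c₀
  ψ-apex y y≢0 = apex (σ ⟨$⟩ʳ y) (y≢0 ∘ permutation-injective σ)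

  ψ-rest : ∀ x y → x ≢ y → x ≢ zero → y ≢ zero → ¬ SameEdge x y (suc zero) (suc (suc zero)) → ψ x y ≡ c₁
  ψ-rest x y x≢y x≢0 y≢0 ¬base = rest _ _ (x≢y ∘ permutation-injective σ) (x≢0 ∘ permutation-injective σ)
    (y≢0 ∘ permutation-injective σ) (¬base ∘ sameEdge-injective σ)

  on-head : ∀ h h′ → h ≢ h′ → ψ (h ↑ˡ m) (h′ ↑ˡ m) ≡ vertexHead c₀ c₁ c₂ h h′
  on-head zero             zero             h≢h′ = ⊥-elim (h≢h′ refl)
  on-head zero             (suc zero)       _    = ψ-apex _ λ ()
  on-head zero             (suc (suc zero)) _    = ψ-apex _ λ ()
  on-head (suc zero)       zero             _    = trans (ψ-sym _ _) (ψ-apex _ λ ())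
  on-head (suc zero)       (suc zero)       h≢h′ = ⊥-elim (h≢h′ refl)
  on-head (suc zero)       (suc (suc zero)) _    = base
  on-head (suc (suc zero)) zero             _    = trans (ψ-sym _ _) (ψ-apex _ λ ())
  on-head (suc (suc zero)) (suc zero)       _    = trans (ψ-sym _ _) base
  on-head (suc (suc zero)) (suc (suc zero)) h≢h′ = ⊥-elim (h≢h′ refl)

  on-link : ∀ h t → ψ (h ↑ˡ m) (3 ↑ʳ t) ≡ vertexLinks c₀ c₁ h
  on-link zero             t = ψ-apex _ λ ()
  on-link (suc zero)       t = ψ-rest _ _ (λ ()) (λ ()) (λ ()) (¬sameEdgeʳ (λ ()) (λ ()))
  on-link (suc (suc zero)) t = ψ-rest _ _ (λ ()) (λ ()) (λ ()) (¬sameEdgeʳ (λ ()) (λ ()))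

  on-tail : ∀ t t′ → t ≢ t′ → ψ (3 ↑ʳ t) (3 ↑ʳ t′) ≡ c₁
  on-tail t t′ t≢t′ = ψ-rest _ _ (t≢t′ ∘ ↑ʳ-injective 3 t t′) (λ ()) (λ ()) (¬sameEdgeˡ (λ ()) (λ ()))

edgeHead : Color → Color → Color → Coloring 4
edgeHead c₁ c₂ c₃ zero                   (suc zero)             = c₁
edgeHead c₁ c₂ c₃ (suc zero)             zero                   = c₁
edgeHead c₁ c₂ c₃ (suc (suc zero))       (suc (suc (suc zero))) = c₂
edgeHead c₁ c₂ c₃ (suc (suc (suc zero))) (suc (suc zero))       = c₂
edgeHead c₁ c₂ c₃ _                      _                      = c₃

edgeSpecial-isCone : ∀ {m} {φ : Coloring (4 + m)} → Symmetric φ → (σ : Permutation′ (4 + m)) →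
  ∀ {a b c d c₁ c₂ c₃} → σ ⟨$⟩ʳ zero ≡ a → σ ⟨$⟩ʳ suc zero ≡ b → σ ⟨$⟩ʳ suc (suc zero) ≡ c →
  σ ⟨$⟩ʳ suc (suc (suc zero)) ≡ d → φ a b ≡ c₁ → φ c d ≡ c₂ →
  (∀ x y → x ≢ y → ¬ SameEdge x y a b → ¬ SameEdge x y c d → φ x y ≡ c₃) →
  IsCone (relabel σ φ) (edgeHead c₁ c₂ c₃) (λ _ → c₃) c₃
edgeSpecial-isCone {m} {φ} φ-sym σ {c₁ = c₁} {c₂} {c₃} refl refl refl refl ab cd rest = record
  { on-head = on-head ; on-link = on-link ; on-tail = on-tail }
  where
  ψ : Coloring (4 + m)
  ψ = relabel σ φ
  ψ-sym : Symmetric ψ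
  ψ-sym = relabel-symmetric σ φ-sym

  ψ-rest : ∀ x y → x ≢ y → ¬ SameEdge x y zero (suc zero) → ¬ SameEdge x y (suc (suc zero)) (suc (suc (suc zero))) →
    ψ x y ≡ c₃
  ψ-rest x y x≢y ¬ab ¬cd =
    rest _ _ (x≢y ∘ permutation-injective σ) (¬ab ∘ sameEdge-injective σ) (¬cd ∘ sameEdge-injective σ)

  across : ∀ x y → x ≢ y → x ≢ zero → x ≢ suc zero → y ≢ suc (suc zero) → y ≢ suc (suc (suc zero)) → ψ x y ≡ c₃
  across x y x≢y x≢0 x≢1 y≢2 y≢3 = ψ-rest x y x≢y (¬sameEdgeˡ x≢0 x≢1) (¬sameEdgeʳ y≢2 y≢3)

  on-head : ∀ h h′ → h ≢ h′ → ψ (h ↑ˡ m) (h′ ↑ˡ m) ≡ edgeHead c₁ c₂ c₃ h h′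
  on-head zero                   zero                   h≢h′ = ⊥-elim (h≢h′ refl)
  on-head zero                   (suc zero)             _    = ab
  on-head zero                   (suc (suc zero))       _    = trans (ψ-sym _ _) (across _ _ (λ ()) (λ ()) (λ ()) (λ ()) (λ ()))
  on-head zero                   (suc (suc (suc zero))) _    = trans (ψ-sym _ _) (across _ _ (λ ()) (λ ()) (λ ()) (λ ()) (λ ()))
  on-head (suc zero)             zero                   _    = trans (ψ-sym _ _) ab
  on-head (suc zero)             (suc zero)             h≢h′ = ⊥-elim (h≢h′ refl)
  on-head (suc zero)             (suc (suc zero))       _    = trans (ψ-sym _ _) (across _ _ (λ ()) (λ ()) (λ ()) (λ ()) (λ ()))
  on-head (suc zero)             (suc (suc (suc zero))) _    = trans (ψ-sym _ _) (across _ _ (λ ()) (λ ()) (λ ()) (λ ()) (λ ()))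
  on-head (suc (suc zero))       zero                   _    = across _ _ (λ ()) (λ ()) (λ ()) (λ ()) (λ ())
  on-head (suc (suc zero))       (suc zero)             _    = across _ _ (λ ()) (λ ()) (λ ()) (λ ()) (λ ())
  on-head (suc (suc zero))       (suc (suc zero))       h≢h′ = ⊥-elim (h≢h′ refl)
  on-head (suc (suc zero))       (suc (suc (suc zero))) _    = cd
  on-head (suc (suc (suc zero))) zero                   _    = across _ _ (λ ()) (λ ()) (λ ()) (λ ()) (λ ())
  on-head (suc (suc (suc zero))) (suc zero)             _    = across _ _ (λ ()) (λ ()) (λ ()) (λ ()) (λ ())
  on-head (suc (suc (suc zero))) (suc (suc zero))       _    = trans (ψ-sym _ _) cd
  on-head (suc (suc (suc zero))) (suc (suc (suc zero))) h≢h′ = ⊥-elim (h≢h′ refl)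

  on-link : ∀ h t → ψ (h ↑ˡ m) (4 ↑ʳ t) ≡ c₃
  on-link h t = ψ-rest _ _ (↑ˡ≢↑ʳ h t) (¬sameEdgeʳ (λ ()) (λ ())) (¬sameEdgeʳ (λ ()) (λ ()))

  on-tail : ∀ t t′ → t ≢ t′ → ψ (4 ↑ʳ t) (4 ↑ʳ t′) ≡ c₃
  on-tail t t′ t≢t′ = ψ-rest _ _ (t≢t′ ∘ ↑ʳ-injective 4 t t′) (¬sameEdgeˡ (λ ()) (λ ())) (¬sameEdgeˡ (λ ()) (λ ()))

-- Both identities are checked by evaluation for all 27 colour triples. The surplus 2 · 0^m in the
-- vertex case vanishes only for a nonempty tail, i.e. n ≥ 4.
vertexCone-excess : ∀ {c₀ c₁ c₂} → Distinct3 c₀ c₁ c₂ →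
  avoidingOne (vertexHead c₀ c₁ c₂) (vertexLinks c₀ c₁) c₀ c₂
    ≡ avoidingBoth (vertexHead c₀ c₁ c₂) (vertexLinks c₀ c₁) c₀ c₂ ⊕ ⟨ 2 , 3 , 2 ^ 3 , 0 ⟩
vertexCone-excess {c₀} {c₁} {c₂} = from-yes
  (∀ᶜ? λ c₀ → ∀ᶜ? λ c₁ → ∀ᶜ? λ c₂ → distinct3? c₀ c₁ c₂ →-dec
    (avoidingOne (vertexHead c₀ c₁ c₂) (vertexLinks c₀ c₁) c₀ c₂
      ≟ᴾ avoidingBoth (vertexHead c₀ c₁ c₂) (vertexLinks c₀ c₁) c₀ c₂ ⊕ ⟨ 2 , 3 , 2 ^ 3 , 0 ⟩))
  c₀ c₁ c₂

edgeCone-excess : ∀ {c₁ c₂ c₃} → Distinct3 c₁ c₂ c₃ →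
  avoidingOne (edgeHead c₁ c₂ c₃) (λ _ → c₃) c₁ c₂
    ≡ avoidingBoth (edgeHead c₁ c₂ c₃) (λ _ → c₃) c₁ c₂ ⊕ ⟨ 0 , 3 , 2 ^ 4 , 0 ⟩
edgeCone-excess {c₁} {c₂} {c₃} = from-yes
  (∀ᶜ? λ c₁ → ∀ᶜ? λ c₂ → ∀ᶜ? λ c₃ → distinct3? c₁ c₂ c₃ →-dec
    (avoidingOne (edgeHead c₁ c₂ c₃) (λ _ → c₃) c₁ c₂
      ≟ᴾ avoidingBoth (edgeHead c₁ c₂ c₃) (λ _ → c₃) c₁ c₂ ⊕ ⟨ 0 , 3 , 2 ^ 4 , 0 ⟩))
  c₁ c₂ c₃

lemma2p6 : (n : ℕ) → 4 ≤ n → (φ : Coloring n) → Symmetric φ → Gallai φ →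
    UsesAllThree φ → Special φ → HasWeight φ (2 ^ n + 3)
lemma2p6 (suc (suc (suc (suc m)))) (s≤s (s≤s (s≤s (s≤s z≤n)))) φ φ-sym gallai _
  (inj₁ (v , c₀ , c₁ , c₂ , a , b , c₀c₁c₂ , apex , a≢b , a≢v , b≢v , ab , rest)) =
  let σ , places = permutation-extending (lookup (v ∷ a ∷ b ∷ []))
                     (lookup-injective ((≢-sym a≢v ∷ ≢-sym b≢v ∷ []) ∷ (a≢b ∷ []) ∷ [] ∷ []) _ _)
  in hasWeight-cone 3 φ-sym gallai σ
       (vertexSpecial-isCone φ-sym σ (places zero) (places (suc zero)) (places (suc (suc zero))) apex ab rest)
       c₀c₁c₂ (vertexCone-excess c₀c₁c₂) refl
lemma2p6 (suc (suc (suc (suc m)))) (s≤s (s≤s (s≤s (s≤s z≤n)))) φ φ-sym gallai _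
  (inj₂ (c₁ , c₂ , c₃ , a , b , c , d , c₁c₂c₃ , (a≢b , a≢c , a≢d , b≢c , b≢d , c≢d) , ab , cd , rest)) =
  let σ , places = permutation-extending (lookup (a ∷ b ∷ c ∷ d ∷ []))
                     (lookup-injective ((a≢b ∷ a≢c ∷ a≢d ∷ []) ∷ (b≢c ∷ b≢d ∷ []) ∷ (c≢d ∷ []) ∷ [] ∷ []) _ _)
  in hasWeight-cone 4 φ-sym gallai σ
       (edgeSpecial-isCone φ-sym σ (places zero) (places (suc zero)) (places (suc (suc zero)))
         (places (suc (suc (suc zero)))) ab cd rest)
       (distinct3-swapʳ c₁c₂c₃) (edgeCone-excess c₁c₂c₃) (*-zeroˡ (0 ^ m))
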